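{- For $n\ge0$, $$\sum_{\sigma\in\mathfrak S_n}(xy)^{{\rm L}(\sigma)}\Bigl(\frac{x+y}{2}\Bigr)^{n-2{\rm L}(\sigma)}\beta^{{\rm RLmin}(\sigma)}=\sum_{\sigma\in\mathfrak S_{n+1}}x^{{\rm des}(\sigma)}y^{n-{\rm des}(\sigma)}\Bigl(\frac{\beta}{2}\Bigr)^{{\rm LRmin}(\sigma)+{\rm RLmin}(\sigma)-2}.$$
   Context: $\mathfrak S_m$ is the set of permutations $\sigma=\sigma_1\cdots\sigma_m$ of $[m]$ ($\mathfrak S_0$ contains only the empty permutation). ${\rm L}(\sigma)$ is the number of left peaks: $1\le i<m$ with $\sigma_{i-1}<\sigma_i>\sigma_{i+1}$, convention $\sigma_0=0$. ${\rm des}(\sigma)$ is the number of $1\le i<m$ with $\sigma_i>\sigma_{i+1}$. ${\rm LRmin}(\sigma)$ (resp. ${\rm RLmin}(\sigma)$) is the number of entries smaller than all entries to their left (resp. right). -}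

module Defs where

open import Data.Nat as ℕ using (ℕ; zero; suc; _<?_)
open import Data.Bool using (Bool; true; false; if_then_else_; _∧_)
open import Data.List using (List; []; _∷_; map; concatMap; filter; foldr; upTo)
open import Data.List.Relation.Unary.All using (all?)
open import Relation.Nullary.Decidable using (⌊_⌋)
import Data.List.Relation.Unary.Unique.DecPropositional as UniqueDec
open import Data.Rational using (ℚ; 1ℚ; 0ℚ; _+_; _*_)

-- Permutations σ = σ₁⋯σₘ of [m] = {1,…,m} are represented as lists of naturals.

words : ℕ → ℕ → List (List ℕ)
words zero    m = [] ∷ []
words (suc k) m = concatMap (λ a → map (a ∷_) (words k m)) (map suc (upTo m))

𝔖 : ℕ → List (List ℕ)
𝔖 m = filter (UniqueDec.unique? ℕ._≟_) (words m m)

[_] : Bool → ℕ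
[ b ] = if b then 1 else 0

des : List ℕ → ℕ
des (a ∷ b ∷ r) = [ ⌊ b <? a ⌋ ] ℕ.+ des (b ∷ r)
des _           = 0

-- left peaks: positions 1 ≤ i < m with σᵢ₋₁ < σᵢ > σᵢ₊₁, with σ₀ = 0
lpkAux : ℕ → List ℕ → ℕ
lpkAux p (a ∷ b ∷ r) = [ ⌊ p <? a ⌋ ∧ ⌊ b <? a ⌋ ] ℕ.+ lpkAux a (b ∷ r)
lpkAux p _           = 0

L : List ℕ → ℕ
L σ = lpkAux 0 σ

-- LRmin: number of entries smaller than all entries to their left
-- (first argument = the entries to the left, in reverse order)
lrminAux : List ℕ → List ℕ → ℕ
lrminAux left []      = 0
lrminAux left (a ∷ r) = [ ⌊ all? (a <?_) left ⌋ ] ℕ.+ lrminAux (a ∷ left) r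

LRmin : List ℕ → ℕ
LRmin σ = lrminAux [] σ

RLmin : List ℕ → ℕ
RLmin []      = 0
RLmin (a ∷ r) = [ ⌊ all? (a <?_) r ⌋ ] ℕ.+ RLmin r

_^_ : ℚ → ℕ → ℚ
x ^ zero  = 1ℚ
x ^ suc n = x * (x ^ n)

sumOver : List (List ℕ) → (List ℕ → ℚ) → ℚ
sumOver S f = foldr (λ σ acc → f σ + acc) 0ℚ S

-- Both sides satisfy F (n + 1) = h (x + y) β F n + D (F n) with h = ½, where D is the derivation with
-- D x = D y = x y and D h = D β = 0: insert a new maximum into every slot of each permutation. On the left,
-- the last slot multiplies the weight (x y)^L (h (x + y))^(n − 2L) β^RLmin by h (x + y) β, and the other
-- slots together apply D (a new left peak turns U = h (x + y) into A = x y, and A into 2 U A). On the right,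
-- the two end slots multiply x^des y^(n − des) (h β)^(LRmin + RLmin − 2) by x h β and y h β, and the inner
-- slots, which replace a factor x or y by x y, apply D. The derivative is computed as the ε-part of the
-- weights over the dual numbers R[ε]; so the identity is proved for every commutative semiring with
-- h + h = 1 at once, and the induction hypothesis in R[ε] equates the two derivative terms.

module Submission where

open import Defs hiding (_^_)

module Permutations where

  open import Function using (_∘_; _⇔_; mk⇔)
  open import Data.Bool using (true; false; _∧_)
  open import Data.Empty using (⊥-elim)
  open import Data.Product using (_×_; _,_; proj₁; proj₂)
  open import Data.Nat as ℕ using (ℕ; zero; suc; _<_; _≤_; _<?_; _≟_; _∸_; z≤n; s≤s)
  import Data.Nat.Properties as ℕₚ
  open import Data.List using (List; []; _∷_; _∷ʳ_; _++_; map; concatMap; filter; upTo; length)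
  import Data.List.Properties as Listₚ
  open import Data.List.Relation.Unary.All as All using (All; []; _∷_)
  import Data.List.Relation.Unary.All.Properties as Allₚ
  open import Data.List.Relation.Unary.Any using (Any; here; there)
  import Data.List.Relation.Unary.AllPairs as AllPairs
  import Data.List.Relation.Unary.AllPairs.Properties as AllPairsₚ
  open import Data.List.Relation.Unary.Unique.Propositional using (Unique)
  import Data.List.Relation.Unary.Unique.Propositional.Properties as Uniqueₚ
  open import Data.List.Relation.Unary.Unique.DecPropositional ℕ._≟_ using (unique?)
  open import Data.List.Relation.Binary.Disjoint.Propositional using (Disjoint)
  open import Data.List.Membership.Propositional using (_∈_; find; lose)
  open import Data.List.Membership.Propositional.Properties
  open import Data.List.Membership.DecPropositional ℕ._≟_ using (_∈?_)
  open import Data.List.Membership.Propositional.Properties.WithK using (unique∧set⇒bag)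
  open import Data.List.Relation.Binary.BagAndSetEquality using (∼bag⇒↭)
  open import Data.List.Relation.Binary.Permutation.Propositional using (_↭_; ↭-refl; ↭-sym; ↭-trans; prep; swap; ↭⇒↭ₛ)
  import Data.List.Relation.Binary.Permutation.Propositional.Properties as ↭ₚ
  import Data.List.Relation.Binary.Permutation.Setoid.Properties as ↭ₛₚ
  open import Relation.Nullary using (¬_; ¬?; Dec; yes; no; _×-dec_)
  open import Relation.Nullary.Decidable using (⌊_⌋; isYes≗does; dec-true; dec-false; does-⇔)
  open import Relation.Binary.PropositionalEquality using (_≡_; _≢_; refl; sym; trans; cong; cong₂; subst; setoid; module ≡-Reasoning)

  private
    variable
      A : Set

  Unique-resp-↭ : {xs ys : List A} → xs ↭ ys → Unique xs → Unique ys
  Unique-resp-↭ {A = A} p = ↭ₛₚ.Unique-resp-↭ (setoid A) (↭⇒↭ₛ p)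

  concatMap-unique : ∀ {B : Set} (f : A → List B) {xs} → All (Unique ∘ f) xs →
    AllPairs.AllPairs (λ x y → Disjoint (f x) (f y)) xs → Unique (concatMap f xs)
  concatMap-unique f uf disj = Uniqueₚ.concat⁺ (Allₚ.map⁺ uf) (AllPairsₚ.map⁺ disj)

  AllPairs-zipWithAll : ∀ {P : A → Set} {R S : A → A → Set} → (∀ {x y} → P x → P y → R x y → S x y) →
    ∀ {xs} → All P xs → AllPairs.AllPairs R xs → AllPairs.AllPairs S xs
  AllPairs-zipWithAll f []         AllPairs.[]        = AllPairs.[]
  AllPairs-zipWithAll f (px ∷ pxs) (rx AllPairs.∷ rxs) =
    All.zipWith (λ (py , r) → f px py r) (pxs , rx) AllPairs.∷ AllPairs-zipWithAll f pxs rxs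

  Unique⇒length≤ : ∀ {xs ys : List A} → Unique xs → (∀ {z} → z ∈ xs → z ∈ ys) → length xs ≤ length ys
  Unique⇒length≤ {xs = []}     _                 _  = z≤n
  Unique⇒length≤ {xs = x ∷ xs} (x∉xs AllPairs.∷ u) xs⊆ys with ∈-∃++ (xs⊆ys (here refl))
  ... | ys₁ , ys₂ , refl = subst (suc (length xs) ≤_) (sym (↭ₚ.↭-length (↭ₚ.shift x ys₁ ys₂)))
          (s≤s (Unique⇒length≤ u xs⊆ys₁++ys₂))
    where
    xs⊆ys₁++ys₂ : ∀ {z} → z ∈ xs → z ∈ ys₁ ++ ys₂
    xs⊆ys₁++ys₂ z∈xs with ↭ₚ.Any-resp-↭ (↭ₚ.shift x ys₁ ys₂) (xs⊆ys (there z∈xs))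
    ... | here refl  = ⊥-elim (All.lookup x∉xs z∈xs refl)
    ... | there z∈ys = z∈ys

  ⌊⌋-true : ∀ {P : Set} (p? : Dec P) → P → ⌊ p? ⌋ ≡ true
  ⌊⌋-true p? p = trans (isYes≗does p?) (dec-true p? p)

  ⌊⌋-false : ∀ {P : Set} (p? : Dec P) → ¬ P → ⌊ p? ⌋ ≡ false
  ⌊⌋-false p? ¬p = trans (isYes≗does p?) (dec-false p? ¬p)

  ⌊⌋-⇔ : ∀ {P Q : Set} → P ⇔ Q → (p? : Dec P) (q? : Dec Q) → ⌊ p? ⌋ ≡ ⌊ q? ⌋
  ⌊⌋-⇔ P⇔Q p? q? = trans (isYes≗does p?) (trans (does-⇔ P⇔Q p? q?) (sym (isYes≗does q?)))

  InRange : ℕ → ℕ → Set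
  InRange m a = 1 ≤ a × a ≤ m

  ∈-words⁻ : ∀ k m {τ} → τ ∈ words k m → length τ ≡ k × All (InRange m) τ
  ∈-words⁻ zero    m (here refl) = refl , []
  ∈-words⁻ (suc k) m τ∈ with find (∈-concatMap⁻ (λ a → map (a ∷_) (words k m)) {xs = map suc (upTo m)} τ∈)
  ... | a , a∈ , τ∈a with ∈-map⁻ suc a∈ | map∷⁻ τ∈a
  ... | i , i∈ , refl | t , t∈ , refl with ∈-words⁻ k m t∈
  ... | |t| , t∈R = cong suc |t| , (s≤s z≤n , ∈-upTo⁻ i∈) ∷ t∈R

  ∈-words⁺ : ∀ k m {τ} → length τ ≡ k → All (InRange m) τ → τ ∈ words k m
  ∈-words⁺ zero    m {[]}        refl []                = here refl
  ∈-words⁺ (suc k) m {suc i ∷ t} |τ|  ((_ , i<m) ∷ t∈R) =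
    ∈-concatMap⁺ _ (lose (∈-map⁺ suc (∈-upTo⁺ i<m)) (∈-map⁺ (suc i ∷_) (∈-words⁺ k m (ℕₚ.suc-injective |τ|) t∈R)))

  words-unique : ∀ k m → Unique (words k m)
  words-unique zero    m = [] AllPairs.∷ AllPairs.[]
  words-unique (suc k) m = concatMap-unique (λ a → map (a ∷_) (words k m))
    (All.universal (λ _ → Uniqueₚ.map⁺ Listₚ.∷-injectiveʳ (words-unique k m)) _)
    (AllPairs.map disjoint (Uniqueₚ.map⁺ ℕₚ.suc-injective (Uniqueₚ.upTo⁺ m)))
    where
    disjoint : ∀ {a b} → a ≢ b → Disjoint (map (a ∷_) (words k m)) (map (b ∷_) (words k m))
    disjoint a≢b (τ∈a , τ∈b) with map∷⁻ τ∈a | map∷⁻ τ∈b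
    ... | _ , _ , refl | _ , _ , eq = a≢b (Listₚ.∷-injectiveˡ eq)

  IsPermutation : ℕ → List ℕ → Set
  IsPermutation m σ = length σ ≡ m × All (InRange m) σ × Unique σ

  ∈-𝔖⁻ : ∀ m {σ} → σ ∈ 𝔖 m → IsPermutation m σ
  ∈-𝔖⁻ m σ∈ with ∈-filter⁻ unique? σ∈
  ... | σ∈words , uσ = proj₁ (∈-words⁻ m m σ∈words) , proj₂ (∈-words⁻ m m σ∈words) , uσ

  ∈-𝔖⁺ : ∀ m {σ} → IsPermutation m σ → σ ∈ 𝔖 m
  ∈-𝔖⁺ m (|σ| , σ∈R , uσ) = ∈-filter⁺ unique? (∈-words⁺ m m |σ| σ∈R) uσ

  𝔖-unique : ∀ m → Unique (𝔖 m)
  𝔖-unique m = Uniqueₚ.filter⁺ unique? (words-unique m m)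

  max∈permutation : ∀ n {τ} → IsPermutation (suc n) τ → suc n ∈ τ
  max∈permutation n {τ} (|τ| , τ∈R , uτ) with suc n ∈? τ
  ... | yes n+1∈τ = n+1∈τ
  ... | no  n+1∉τ = ⊥-elim (ℕₚ.<-irrefl refl (begin
    suc n                      ≡⟨ sym |τ| ⟩
    length τ                   ≤⟨ Unique⇒length≤ uτ τ⊆1-to-n ⟩
    length (map suc (upTo n))  ≡⟨ trans (Listₚ.length-map suc (upTo n)) (Listₚ.length-upTo n) ⟩
    n                          ∎))
    where
    open ℕₚ.≤-Reasoning
    τ⊆1-to-n : ∀ {z} → z ∈ τ → z ∈ map suc (upTo n)
    τ⊆1-to-n {z} z∈τ with All.lookup τ∈R z∈τ
    τ⊆1-to-n {suc i} z∈τ | _ , i≤n = ∈-map⁺ suc (∈-upTo⁺ (ℕₚ.≤∧≢⇒< (ℕₚ.≤-pred i≤n) (λ { refl → n+1∉τ z∈τ })))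

  insertions : ℕ → List ℕ → List (List ℕ)
  insertions M []      = (M ∷ []) ∷ []
  insertions M (a ∷ σ) = (M ∷ a ∷ σ) ∷ map (a ∷_) (insertions M σ)

  innerInsertions : ℕ → List ℕ → List (List ℕ)
  innerInsertions M []      = []
  innerInsertions M (a ∷ σ) = (M ∷ a ∷ σ) ∷ map (a ∷_) (innerInsertions M σ)

  insertions≡innerInsertions∷ʳ : ∀ M σ → insertions M σ ≡ innerInsertions M σ ∷ʳ (σ ∷ʳ M)
  insertions≡innerInsertions∷ʳ M []      = refl
  insertions≡innerInsertions∷ʳ M (a ∷ σ) = cong ((M ∷ a ∷ σ) ∷_)
    (trans (cong (map (a ∷_)) (insertions≡innerInsertions∷ʳ M σ)) (Listₚ.map-++ (a ∷_) (innerInsertions M σ) _))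

  ∈-innerInsertions⇒∈-insertions : ∀ M σ {τ} → τ ∈ innerInsertions M σ → τ ∈ insertions M σ
  ∈-innerInsertions⇒∈-insertions M σ τ∈ = subst (_ ∈_) (sym (insertions≡innerInsertions∷ʳ M σ)) (∈-++⁺ˡ τ∈)

  ∈-insertions⇒↭ : ∀ M σ {τ} → τ ∈ insertions M σ → τ ↭ M ∷ σ
  ∈-insertions⇒↭ M []      (here refl) = ↭-refl
  ∈-insertions⇒↭ M (a ∷ σ) (here refl) = ↭-refl
  ∈-insertions⇒↭ M (a ∷ σ) (there τ∈) with map∷⁻ τ∈
  ... | t , t∈ , refl = ↭-trans (prep a (∈-insertions⇒↭ M σ t∈)) (swap a M ↭-refl)

  ++-∈-insertions : ∀ M l₁ l₂ → l₁ ++ M ∷ l₂ ∈ insertions M (l₁ ++ l₂)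
  ++-∈-insertions M []       []       = here refl
  ++-∈-insertions M []       (b ∷ l₂) = here refl
  ++-∈-insertions M (a ∷ l₁) l₂       = there (∈-map⁺ (a ∷_) (++-∈-insertions M l₁ l₂))

  without : ℕ → List ℕ → List ℕ
  without M = filter (¬? ∘ (_≟ M))

  without-insertions : ∀ M σ {τ} → All (_≢ M) σ → τ ∈ insertions M σ → without M τ ≡ σ
  without-insertions M []      _             (here refl) = Listₚ.filter-reject (¬? ∘ (_≟ M)) (λ M≢M → M≢M refl)
  without-insertions M (a ∷ σ) aσ≢M          (here refl) =
    trans (Listₚ.filter-reject (¬? ∘ (_≟ M)) (λ M≢M → M≢M refl)) (Listₚ.filter-all (¬? ∘ (_≟ M)) aσ≢M)
  without-insertions M (a ∷ σ) (a≢M ∷ σ≢M) (there τ∈) with map∷⁻ τ∈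
  ... | t , t∈ , refl =
    trans (Listₚ.filter-accept (¬? ∘ (_≟ M)) a≢M) (cong (a ∷_) (without-insertions M σ σ≢M t∈))

  insertions-unique : ∀ M σ → All (_≢ M) σ → Unique (insertions M σ)
  insertions-unique M []      _             = [] AllPairs.∷ AllPairs.[]
  insertions-unique M (a ∷ σ) (a≢M ∷ σ≢M) =
    Allₚ.map⁺ (All.universal (λ _ eq → a≢M (sym (Listₚ.∷-injectiveˡ eq))) _)
      AllPairs.∷ Uniqueₚ.map⁺ Listₚ.∷-injectiveʳ (insertions-unique M σ σ≢M)

  insertions-disjoint : ∀ M {σ σ′} → All (_≢ M) σ → All (_≢ M) σ′ → σ ≢ σ′ →
    Disjoint (insertions M σ) (insertions M σ′)
  insertions-disjoint M σ≢M σ′≢M σ≢σ′ (τ∈ , τ∈′) =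
    σ≢σ′ (trans (sym (without-insertions M _ σ≢M τ∈)) (without-insertions M _ σ′≢M τ∈′))

  𝔖-length : ∀ n {σ} → σ ∈ 𝔖 n → length σ ≡ n
  𝔖-length n = proj₁ ∘ ∈-𝔖⁻ n

  𝔖-bounded : ∀ n {σ} → σ ∈ 𝔖 n → All (_< suc n) σ
  𝔖-bounded n = All.map (s≤s ∘ proj₂) ∘ proj₁ ∘ proj₂ ∘ ∈-𝔖⁻ n

  IsPermutation-resp-↭ : ∀ {m σ τ} → σ ↭ τ → IsPermutation m σ → IsPermutation m τ
  IsPermutation-resp-↭ σ↭τ (|σ| , σ∈R , uσ) =
    trans (sym (↭ₚ.↭-length σ↭τ)) |σ| , ↭ₚ.All-resp-↭ σ↭τ σ∈R , Unique-resp-↭ σ↭τ uσ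

  max∷-IsPermutation : ∀ n {σ} → IsPermutation n σ → IsPermutation (suc n) (suc n ∷ σ)
  max∷-IsPermutation n (|σ| , σ∈R , uσ) =
    cong suc |σ| ,
    (s≤s z≤n , ℕₚ.≤-refl) ∷ All.map (λ (1≤a , a≤n) → 1≤a , ℕₚ.m≤n⇒m≤1+n a≤n) σ∈R ,
    All.map (λ (_ , a≤n) → ℕₚ.>⇒≢ (s≤s a≤n)) σ∈R AllPairs.∷ uσ

  max∷-IsPermutation⁻ : ∀ n {σ} → IsPermutation (suc n) (suc n ∷ σ) → IsPermutation n σ
  max∷-IsPermutation⁻ n (|σ|+1 , (_ ∷ σ∈R) , (n+1∉σ AllPairs.∷ uσ)) =
    ℕₚ.suc-injective |σ|+1 ,
    All.zipWith (λ ((1≤a , a≤n+1) , n+1≢a) → 1≤a , ℕₚ.≤-pred (ℕₚ.≤∧≢⇒< a≤n+1 (n+1≢a ∘ sym))) (σ∈R , n+1∉σ) ,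
    uσ

  𝔖-suc-↭ : ∀ n → 𝔖 (suc n) ↭ concatMap (insertions (suc n)) (𝔖 n)
  𝔖-suc-↭ n = ∼bag⇒↭ (unique∧set⇒bag (𝔖-unique (suc n)) unique (mk⇔ to from))
    where
    unique : Unique (concatMap (insertions (suc n)) (𝔖 n))
    unique = concatMap-unique (insertions (suc n))
      (All.map (insertions-unique (suc n) _) 𝔖≢max)
      (AllPairs-zipWithAll (insertions-disjoint (suc n)) 𝔖≢max (𝔖-unique n))
      where
      𝔖≢max : All (All (_≢ suc n)) (𝔖 n)
      𝔖≢max = All.tabulate (All.map ℕₚ.<⇒≢ ∘ 𝔖-bounded n)
    to : ∀ {τ} → τ ∈ 𝔖 (suc n) → τ ∈ concatMap (insertions (suc n)) (𝔖 n)
    to τ∈ with ∈-∃++ (max∈permutation n (∈-𝔖⁻ (suc n) τ∈))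
    ... | l₁ , l₂ , refl = ∈-concatMap⁺ (insertions (suc n))
      (lose (∈-𝔖⁺ n (max∷-IsPermutation⁻ n (IsPermutation-resp-↭ (↭ₚ.shift (suc n) l₁ l₂) (∈-𝔖⁻ (suc n) τ∈))))
            (++-∈-insertions (suc n) l₁ l₂))
    from : ∀ {τ} → τ ∈ concatMap (insertions (suc n)) (𝔖 n) → τ ∈ 𝔖 (suc n)
    from τ∈ with find (∈-concatMap⁻ (insertions (suc n)) τ∈)
    ... | σ , σ∈ , τ∈σ = ∈-𝔖⁺ (suc n)
      (IsPermutation-resp-↭ (↭-sym (∈-insertions⇒↭ (suc n) σ τ∈σ)) (max∷-IsPermutation n (∈-𝔖⁻ n σ∈)))

  RLmin-∷ʳ-max : ∀ M σ → All (_< M) σ → RLmin (σ ∷ʳ M) ≡ suc (RLmin σ)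
  RLmin-∷ʳ-max M []      _           = refl
  RLmin-∷ʳ-max M (a ∷ σ) (a<M ∷ σ<M) = trans
    (cong₂ (λ b k → [ b ] ℕ.+ k)
      (⌊⌋-⇔ (mk⇔ (proj₁ ∘ Allₚ.∷ʳ⁻) (λ a<σ → Allₚ.∷ʳ⁺ a<σ a<M)) (All.all? (a <?_) (σ ∷ʳ M)) (All.all? (a <?_) σ))
      (RLmin-∷ʳ-max M σ σ<M))
    (ℕₚ.+-suc [ ⌊ All.all? (a <?_) σ ⌋ ] (RLmin σ))

  RLmin-innerInsertions : ∀ M σ {τ} → All (_< M) σ → τ ∈ innerInsertions M σ → RLmin τ ≡ RLmin σ
  RLmin-innerInsertions M (a ∷ σ) (a<M ∷ _)   (here refl) =
    cong (λ b → [ b ] ℕ.+ RLmin (a ∷ σ)) (⌊⌋-false (All.all? (M <?_) (a ∷ σ)) (ℕₚ.<-asym a<M ∘ All.head))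
  RLmin-innerInsertions M (a ∷ σ) (a<M ∷ σ<M) (there τ∈) with map∷⁻ τ∈
  ... | t , t∈ , refl = cong₂ (λ b k → [ b ] ℕ.+ k)
    (⌊⌋-⇔ (mk⇔ (All.tail ∘ ↭ₚ.All-resp-↭ t↭) (↭ₚ.All-resp-↭ (↭-sym t↭) ∘ (a<M ∷_))) _ _)
    (RLmin-innerInsertions M σ σ<M t∈)
    where
    t↭ = ∈-insertions⇒↭ M σ (∈-innerInsertions⇒∈-insertions M σ t∈)

  1≤RLmin : ∀ a σ → 1 ≤ RLmin (a ∷ σ)
  1≤RLmin a []      = s≤s z≤n
  1≤RLmin a (b ∷ σ) = ℕₚ.≤-trans (1≤RLmin b σ) (ℕₚ.m≤n+m (RLmin (b ∷ σ)) [ ⌊ All.all? (a <?_) (b ∷ σ) ⌋ ])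

  lrminAux-max∷ : ∀ M l₁ l₂ σ → All (_< M) σ → lrminAux (l₁ ++ M ∷ l₂) σ ≡ lrminAux (l₁ ++ l₂) σ
  lrminAux-max∷ M l₁ l₂ []      _           = refl
  lrminAux-max∷ M l₁ l₂ (a ∷ σ) (a<M ∷ σ<M) = cong₂ (λ b k → [ b ] ℕ.+ k)
    (⌊⌋-⇔ (mk⇔ (All.tail ∘ ↭ₚ.All-resp-↭ l↭) (↭ₚ.All-resp-↭ (↭-sym l↭) ∘ (a<M ∷_))) _ _)
    (lrminAux-max∷ M (a ∷ l₁) l₂ σ σ<M)
    where
    l↭ = ↭ₚ.shift M l₁ l₂

  LRmin-max∷ : ∀ M σ → All (_< M) σ → LRmin (M ∷ σ) ≡ suc (LRmin σ)
  LRmin-max∷ M σ σ<M = cong suc (lrminAux-max∷ M [] [] σ σ<M)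

  max-not-below : ∀ {M l} → Any (_< M) l → ¬ All (M <_) l
  max-not-below (here a<M)  (M<a ∷ _) = ℕₚ.<-asym a<M M<a
  max-not-below (there a∈l) (_ ∷ M<l) = max-not-below a∈l M<l

  lrminAux-innerInsertions : ∀ M l σ {τ} → Any (_< M) l → All (_< M) σ → τ ∈ innerInsertions M σ →
    lrminAux l τ ≡ lrminAux l σ
  lrminAux-innerInsertions M l (a ∷ σ) l≮M σ<M (here refl) =
    cong₂ (λ b k → [ b ] ℕ.+ k) (⌊⌋-false (All.all? (M <?_) l) (max-not-below l≮M)) (lrminAux-max∷ M [] l (a ∷ σ) σ<M)
  lrminAux-innerInsertions M l (a ∷ σ) l≮M (_ ∷ σ<M) (there τ∈) with map∷⁻ τ∈
  ... | t , t∈ , refl = cong ([ ⌊ All.all? (a <?_) l ⌋ ] ℕ.+_) (lrminAux-innerInsertions M (a ∷ l) σ (there l≮M) σ<M t∈)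

  lrminAux-∷ʳ-max : ∀ M l σ → Any (_< M) l → All (_< M) σ → lrminAux l (σ ∷ʳ M) ≡ lrminAux l σ
  lrminAux-∷ʳ-max M l []      l≮M _          = cong (λ b → [ b ] ℕ.+ 0) (⌊⌋-false (All.all? (M <?_) l) (max-not-below l≮M))
  lrminAux-∷ʳ-max M l (a ∷ σ) l≮M (_ ∷ σ<M) =
    cong ([ ⌊ All.all? (a <?_) l ⌋ ] ℕ.+_) (lrminAux-∷ʳ-max M (a ∷ l) σ (there l≮M) σ<M)

  IsLeftPeak : ℕ → ℕ → ℕ → Set
  IsLeftPeak p a b = p < a × b < a

  isLeftPeak? : ∀ p a b → Dec (IsLeftPeak p a b)
  isLeftPeak? p a b = (p <? a) ×-dec (b <? a)

  lpkAux-peak : ∀ {p a b} σ → IsLeftPeak p a b → lpkAux p (a ∷ b ∷ σ) ≡ suc (lpkAux b σ)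
  lpkAux-peak {p} {a} {b} σ (p<a , b<a) with p <? a | b <? a
  ... | yes _   | yes _   = cong suc (lpkAux-descent σ)
    where
    lpkAux-descent : ∀ σ → lpkAux a (b ∷ σ) ≡ lpkAux b σ
    lpkAux-descent []      = refl
    lpkAux-descent (d ∷ σ) = cong (λ x → [ x ∧ ⌊ d <? b ⌋ ] ℕ.+ lpkAux b (d ∷ σ)) (⌊⌋-false (a <? b) (ℕₚ.<-asym b<a))
  ... | no p≮a  | _       = ⊥-elim (p≮a p<a)
  ... | yes _   | no b≮a  = ⊥-elim (b≮a b<a)

  lpkAux-nonpeak : ∀ {p a b} σ → ¬ IsLeftPeak p a b → lpkAux p (a ∷ b ∷ σ) ≡ lpkAux a (b ∷ σ)
  lpkAux-nonpeak {p} {a} {b} σ ¬peak with p <? a | b <? a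
  ... | yes p<a | yes b<a = ⊥-elim (¬peak (p<a , b<a))
  ... | no _    | _       = refl
  ... | yes _   | no _    = refl

  2*lpkAux≤length : ∀ p σ → 2 ℕ.* lpkAux p σ ≤ length σ
  2*lpkAux≤length p []          = z≤n
  2*lpkAux≤length p (a ∷ [])    = z≤n
  2*lpkAux≤length p (a ∷ b ∷ σ)
    with 2*lpkAux≤length b σ | 2*lpkAux≤length a (b ∷ σ) | isLeftPeak? p a b
  ... | ih | _ | yes peak = begin
    2 ℕ.* lpkAux p (a ∷ b ∷ σ)  ≡⟨ cong (2 ℕ.*_) (lpkAux-peak σ peak) ⟩
    2 ℕ.* suc (lpkAux b σ)      ≡⟨ ℕₚ.*-suc 2 (lpkAux b σ) ⟩
    2 ℕ.+ 2 ℕ.* lpkAux b σ      ≤⟨ ℕₚ.+-monoʳ-≤ 2 ih ⟩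
    2 ℕ.+ length σ              ∎
    where open ℕₚ.≤-Reasoning
  ... | _ | ih | no ¬peak = begin
    2 ℕ.* lpkAux p (a ∷ b ∷ σ)  ≡⟨ cong (2 ℕ.*_) (lpkAux-nonpeak σ ¬peak) ⟩
    2 ℕ.* lpkAux a (b ∷ σ)      ≤⟨ ih ⟩
    length (b ∷ σ)              ≤⟨ ℕₚ.n≤1+n _ ⟩
    length (a ∷ b ∷ σ)          ∎
    where open ℕₚ.≤-Reasoning

  des≤length : ∀ a σ → des (a ∷ σ) ≤ length σ
  des≤length a []      = z≤n
  des≤length a (b ∷ σ) = ℕₚ.+-mono-≤ (indicator≤1 ⌊ b <? a ⌋) (des≤length b σ)
    where
    indicator≤1 : ∀ x → [ x ] ≤ 1
    indicator≤1 true  = s≤s z≤n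
    indicator≤1 false = z≤n

  excessMinima : List ℕ → ℕ
  excessMinima σ = LRmin σ ℕ.+ RLmin σ ∸ 2

  2≤LRmin+RLmin : ∀ a σ → 2 ≤ LRmin (a ∷ σ) ℕ.+ RLmin (a ∷ σ)
  2≤LRmin+RLmin a σ = s≤s (ℕₚ.≤-trans (1≤RLmin a σ) (ℕₚ.m≤n+m (RLmin (a ∷ σ)) (lrminAux (a ∷ []) σ)))

  excessMinima-max∷ : ∀ M a σ → All (_< M) (a ∷ σ) → excessMinima (M ∷ a ∷ σ) ≡ suc (excessMinima (a ∷ σ))
  excessMinima-max∷ M a σ aσ<M = begin
    LRmin (M ∷ a ∷ σ) ℕ.+ RLmin (M ∷ a ∷ σ) ∸ 2
      ≡⟨ cong₂ (λ l r → l ℕ.+ r ∸ 2) (LRmin-max∷ M (a ∷ σ) aσ<M) (RLmin-innerInsertions M (a ∷ σ) aσ<M (here refl)) ⟩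
    suc (LRmin (a ∷ σ) ℕ.+ RLmin (a ∷ σ)) ∸ 2
      ≡⟨ ℕₚ.+-∸-assoc 1 (2≤LRmin+RLmin a σ) ⟩
    suc (excessMinima (a ∷ σ)) ∎
    where open ≡-Reasoning

  excessMinima-∷ʳ-max : ∀ M a σ → All (_< M) (a ∷ σ) → excessMinima (a ∷ σ ∷ʳ M) ≡ suc (excessMinima (a ∷ σ))
  excessMinima-∷ʳ-max M a σ (a<M ∷ σ<M) = begin
    LRmin (a ∷ σ ∷ʳ M) ℕ.+ RLmin (a ∷ σ ∷ʳ M) ∸ 2
      ≡⟨ cong₂ (λ l r → l ℕ.+ r ∸ 2) (cong suc (lrminAux-∷ʳ-max M (a ∷ []) σ (here a<M) σ<M))
                                     (RLmin-∷ʳ-max M (a ∷ σ) (a<M ∷ σ<M)) ⟩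
    LRmin (a ∷ σ) ℕ.+ suc (RLmin (a ∷ σ)) ∸ 2
      ≡⟨ cong (_∸ 2) (ℕₚ.+-suc (LRmin (a ∷ σ)) (RLmin (a ∷ σ))) ⟩
    suc (LRmin (a ∷ σ) ℕ.+ RLmin (a ∷ σ)) ∸ 2
      ≡⟨ ℕₚ.+-∸-assoc 1 (2≤LRmin+RLmin a σ) ⟩
    suc (excessMinima (a ∷ σ)) ∎
    where open ≡-Reasoning

  excessMinima-innerInsertions : ∀ M a σ {τ} → All (_< M) (a ∷ σ) → τ ∈ innerInsertions M σ →
    excessMinima (a ∷ τ) ≡ excessMinima (a ∷ σ)
  excessMinima-innerInsertions M a σ (a<M ∷ σ<M) τ∈ = cong₂ (λ l r → l ℕ.+ r ∸ 2)
    (cong suc (lrminAux-innerInsertions M (a ∷ []) σ (here a<M) σ<M τ∈))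
    (RLmin-innerInsertions M (a ∷ σ) (a<M ∷ σ<M) (there (∈-map⁺ (a ∷_) τ∈)))

open Permutations

open import Function using (_∘_)
open import Algebra using (CommutativeSemiring; CommutativeMonoid; IsCommutativeMonoid)
import Algebra.Construct.DirectProduct as DirectProduct
open import Algebra.Structures.Biased using (isCommutativeSemiringˡ)
open import Data.Product using (_×_; _,_; proj₁; proj₂)
open import Data.Nat as ℕ using (ℕ; zero; suc; _<_; _<?_; _∸_; z≤n; s≤s)
import Data.Nat.Properties as ℕₚ
open import Data.Bool using (if_then_else_)
open import Relation.Nullary using (¬_; yes; no)
open import Relation.Nullary.Decidable using (⌊_⌋)
open import Data.List using (List; []; _∷_; _∷ʳ_; _++_; map; concatMap; foldr; length)
import Data.List.Properties as Listₚ
open import Data.List.Relation.Unary.All as All using (All; _∷_)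
open import Data.List.Relation.Unary.Any using (here; there)
open import Data.List.Membership.Propositional using (_∈_)
open import Data.List.Membership.Propositional.Properties using (map∷⁻)
open import Data.List.Relation.Binary.Permutation.Propositional using (_↭_; ↭⇒↭ₛ′)
import Data.List.Relation.Binary.Permutation.Propositional.Properties as ↭ₚ
import Data.List.Relation.Binary.Permutation.Setoid.Properties as ↭ₛₚ
import Relation.Binary.PropositionalEquality as ≡
open ≡ using (_≡_)

module Sums {c ℓ} (R : CommutativeSemiring c ℓ) where

  open CommutativeSemiring R
  open import Relation.Binary.Reasoning.Setoid setoid
  open import Algebra.Solver.Ring.NaturalCoefficients.Default R

  private
    variable
      I J : Set

  ∑ : List I → (I → Carrier) → Carrier
  ∑ S f = foldr (λ σ s → f σ + s) 0# S

  ∑-cong : ∀ (S : List I) {f g} → (∀ {σ} → σ ∈ S → f σ ≈ g σ) → ∑ S f ≈ ∑ S g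
  ∑-cong []      f≈g = refl
  ∑-cong (σ ∷ S) f≈g = +-cong (f≈g (here ≡.refl)) (∑-cong S (f≈g ∘ there))

  ∑-++ : ∀ (S T : List I) f → ∑ (S ++ T) f ≈ ∑ S f + ∑ T f
  ∑-++ []      T f = sym (+-identityˡ _)
  ∑-++ (σ ∷ S) T f = trans (+-congˡ (∑-++ S T f)) (sym (+-assoc _ _ _))

  ∑-concatMap : ∀ (g : J → List I) (S : List J) f → ∑ (concatMap g S) f ≈ ∑ S (λ σ → ∑ (g σ) f)
  ∑-concatMap g []      f = refl
  ∑-concatMap g (σ ∷ S) f = trans (∑-++ (g σ) (concatMap g S) f) (+-congˡ (∑-concatMap g S f))

  ∑-map : ∀ (g : J → I) (S : List J) f → ∑ (map g S) f ≡ ∑ S (f ∘ g)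
  ∑-map g []      f = ≡.refl
  ∑-map g (σ ∷ S) f = ≡.cong (f (g σ) +_) (∑-map g S f)

  ∑-+ : ∀ (S : List I) f g → ∑ S (λ σ → f σ + g σ) ≈ ∑ S f + ∑ S g
  ∑-+ []      f g = sym (+-identityˡ _)
  ∑-+ (σ ∷ S) f g = trans (+-congˡ (∑-+ S f g))
    (solve 4 (λ a b c d → (a :+ b) :+ (c :+ d) := (a :+ c) :+ (b :+ d)) refl _ _ _ _)

  ∑-*ˡ : ∀ (S : List I) a f → ∑ S (λ σ → a * f σ) ≈ a * ∑ S f
  ∑-*ˡ []      a f = sym (zeroʳ a)
  ∑-*ˡ (σ ∷ S) a f = trans (+-congˡ (∑-*ˡ S a f)) (sym (distribˡ _ _ _))

  ∑-*ʳ : ∀ (S : List I) a f → ∑ S (λ σ → f σ * a) ≈ ∑ S f * a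
  ∑-*ʳ []      a f = sym (zeroˡ a)
  ∑-*ʳ (σ ∷ S) a f = trans (+-congˡ (∑-*ʳ S a f)) (sym (distribʳ _ _ _))

  ∑-↭ : ∀ {S T : List I} f → S ↭ T → ∑ S f ≈ ∑ T f
  ∑-↭ {S = S} {T} f S↭T = begin
    ∑ S f                   ≡⟨ ≡.sym (Listₚ.foldr-map _+_ f 0# S) ⟩
    foldr _+_ 0# (map f S)  ≈⟨ ↭ₛₚ.foldr-commMonoid setoid +-isCommutativeMonoid (↭⇒↭ₛ′ isEquivalence (↭ₚ.map⁺ f S↭T)) ⟩
    foldr _+_ 0# (map f T)  ≡⟨ Listₚ.foldr-map _+_ f 0# T ⟩
    ∑ T f                   ∎

module DualNumbers {c ℓ} (R : CommutativeSemiring c ℓ) where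

  open CommutativeSemiring R
  open import Algebra.Solver.Ring.NaturalCoefficients.Default R
  private
    module R² = CommutativeMonoid (DirectProduct.commutativeMonoid +-commutativeMonoid +-commutativeMonoid)

  -- (a , a′) represents a + a′ ε with ε² = 0.
  infixl 7 _*ε_
  _*ε_ : Carrier × Carrier → Carrier × Carrier → Carrier × Carrier
  (a , a′) *ε (b , b′) = a * b , a * b′ + a′ * b

  *ε-isCommutativeMonoid : IsCommutativeMonoid R²._≈_ _*ε_ (1# , 0#)
  *ε-isCommutativeMonoid = record
    { isMonoid = record
      { isSemigroup = record
        { isMagma = record
          { isEquivalence = R².isEquivalence
          ; ∙-cong = λ (a≈ , a′≈) (b≈ , b′≈) → *-cong a≈ b≈ , +-cong (*-cong a≈ b′≈) (*-cong a′≈ b≈)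
          }
        ; assoc = λ (a , a′) (b , b′) (d , d′) → *-assoc a b d ,
            solve 6 (λ a a′ b b′ d d′ → (a :* b) :* d′ :+ (a :* b′ :+ a′ :* b) :* d
                                      := a :* (b :* d′ :+ b′ :* d) :+ a′ :* (b :* d)) refl a a′ b b′ d d′
        }
      ; identity = (λ (a , a′) → *-identityˡ a , solve 2 (λ a a′ → con 1 :* a′ :+ con 0 :* a := a′) refl a a′)
                 , (λ (a , a′) → *-identityʳ a , solve 2 (λ a a′ → a :* con 0 :+ a′ :* con 1 := a′) refl a a′)
      }
    ; comm = λ (a , a′) (b , b′) → *-comm a b ,
        solve 4 (λ a a′ b b′ → a :* b′ :+ a′ :* b := b :* a′ :+ b′ :* a) refl a a′ b b′
    }

  R[ε] : CommutativeSemiring c ℓ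
  R[ε] = record
    { isCommutativeSemiring = isCommutativeSemiringˡ record
      { +-isCommutativeMonoid = R².isCommutativeMonoid
      ; *-isCommutativeMonoid = *ε-isCommutativeMonoid
      ; distribʳ = λ (a , a′) (b , b′) (d , d′) → distribʳ a b d ,
          solve 6 (λ a a′ b b′ d d′ → (b :+ d) :* a′ :+ (b′ :+ d′) :* a := (b :* a′ :+ b′ :* a) :+ (d :* a′ :+ d′ :* a))
            refl a a′ b b′ d d′
      ; zeroˡ = λ (a , a′) → zeroˡ a , solve 2 (λ a a′ → con 0 :* a′ :+ con 0 :* a := con 0) refl a a′
      }
    }

module Weights {c ℓ} (R : CommutativeSemiring c ℓ) where

  open CommutativeSemiring R
  open Sums R
  open import Algebra.Definitions.RawSemiring rawSemiring using (_^_)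
  open import Relation.Binary.Reasoning.Setoid setoid
  open import Algebra.Solver.Ring.NaturalCoefficients.Default R
  open import Algebra.Properties.CommutativeSemigroup *-commutativeSemigroup using (x∙yz≈y∙xz)

  -- p is the entry before σ; a left peak weighs A together with the entry after it, any other entry U.
  peakWeight : Carrier → Carrier → ℕ → List ℕ → Carrier
  peakWeight A U p []          = 1#
  peakWeight A U p (a ∷ [])    = U
  peakWeight A U p (a ∷ b ∷ σ) =
    if ⌊ isLeftPeak? p a b ⌋ then A * peakWeight A U b σ else U * peakWeight A U a (b ∷ σ)

  stepWeight : Carrier → Carrier → ℕ → ℕ → Carrier
  stepWeight X Y a b = if ⌊ b <? a ⌋ then X else Y

  descentWeight : Carrier → Carrier → List ℕ → Carrier
  descentWeight X Y (a ∷ b ∷ σ) = stepWeight X Y a b * descentWeight X Y (b ∷ σ)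
  descentWeight X Y _           = 1#

  module _ {A U : Carrier} where

    peakWeight-peak : ∀ {p a b} σ → IsLeftPeak p a b → peakWeight A U p (a ∷ b ∷ σ) ≡ A * peakWeight A U b σ
    peakWeight-peak {p} {a} {b} σ peak =
      ≡.cong (λ x → if x then _ else U * peakWeight A U a (b ∷ σ)) (⌊⌋-true (isLeftPeak? p a b) peak)

    peakWeight-nonpeak : ∀ {p a b} σ → ¬ IsLeftPeak p a b → peakWeight A U p (a ∷ b ∷ σ) ≡ U * peakWeight A U a (b ∷ σ)
    peakWeight-nonpeak {p} {a} {b} σ ¬peak =
      ≡.cong (λ x → if x then A * peakWeight A U b σ else _) (⌊⌋-false (isLeftPeak? p a b) ¬peak)

    peakWeight-pow : ∀ p σ → peakWeight A U p σ ≈ A ^ lpkAux p σ * U ^ (length σ ∸ 2 ℕ.* lpkAux p σ)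
    peakWeight-pow p []          = sym (*-identityˡ 1#)
    peakWeight-pow p (a ∷ [])    = solve 1 (λ u → u := con 1 :* (u :* con 1)) refl U
    peakWeight-pow p (a ∷ b ∷ σ)
      with peakWeight-pow b σ | peakWeight-pow a (b ∷ σ) | 2*lpkAux≤length a (b ∷ σ) | isLeftPeak? p a b
    ... | ih | _ | _ | yes peak = begin
      A * peakWeight A U b σ                   ≈⟨ *-congˡ ih ⟩
      A * (A ^ k * U ^ (length σ ∸ 2 ℕ.* k))   ≈⟨ *-assoc A _ _ ⟨
      A ^ suc k * U ^ (length σ ∸ 2 ℕ.* k)     ≡⟨ ≡.cong₂ (λ i j → A ^ i * U ^ j) (≡.sym (lpkAux-peak σ peak)) length∸ ⟩
      A ^ lpkAux p (a ∷ b ∷ σ) * U ^ (length (a ∷ b ∷ σ) ∸ 2 ℕ.* lpkAux p (a ∷ b ∷ σ)) ∎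
      where
      k = lpkAux b σ
      length∸ : length σ ∸ 2 ℕ.* k ≡ length (a ∷ b ∷ σ) ∸ 2 ℕ.* lpkAux p (a ∷ b ∷ σ)
      length∸ = ≡.trans (≡.sym (≡.cong (length (b ∷ σ) ∸_) (ℕₚ.+-suc k (k ℕ.+ 0))))
                        (≡.cong (λ i → length (a ∷ b ∷ σ) ∸ 2 ℕ.* i) (≡.sym (lpkAux-peak σ peak)))
    ... | _ | ih | 2k≤ | no ¬peak = begin
      U * peakWeight A U a (b ∷ σ)                             ≈⟨ *-congˡ ih ⟩
      U * (A ^ k * U ^ (length (b ∷ σ) ∸ 2 ℕ.* k))             ≈⟨ x∙yz≈y∙xz U _ _ ⟩
      A ^ k * U ^ suc (length (b ∷ σ) ∸ 2 ℕ.* k)               ≡⟨ ≡.cong₂ (λ i j → A ^ i * U ^ j) (≡.sym (lpkAux-nonpeak σ ¬peak)) length∸ ⟩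
      A ^ lpkAux p (a ∷ b ∷ σ) * U ^ (length (a ∷ b ∷ σ) ∸ 2 ℕ.* lpkAux p (a ∷ b ∷ σ)) ∎
      where
      k = lpkAux a (b ∷ σ)
      length∸ : suc (length (b ∷ σ) ∸ 2 ℕ.* k) ≡ length (a ∷ b ∷ σ) ∸ 2 ℕ.* lpkAux p (a ∷ b ∷ σ)
      length∸ = ≡.trans (≡.sym (ℕₚ.+-∸-assoc 1 2k≤))
                        (≡.cong (λ i → length (a ∷ b ∷ σ) ∸ 2 ℕ.* i) (≡.sym (lpkAux-nonpeak σ ¬peak)))

    peakWeight-descent : ∀ {a b} σ → b < a → peakWeight A U a (b ∷ σ) ≈ U * peakWeight A U b σ
    peakWeight-descent []      _   = sym (*-identityʳ U)
    peakWeight-descent (d ∷ σ) b<a = reflexive (peakWeight-nonpeak σ (λ (a<b , _) → ℕₚ.<-asym a<b b<a))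

    peakWeight-∷ʳ-max : ∀ M p σ → All (_< M) σ → peakWeight A U p (σ ∷ʳ M) ≈ peakWeight A U p σ * U
    peakWeight-∷ʳ-max M p []          _                   = sym (*-identityˡ U)
    peakWeight-∷ʳ-max M p (a ∷ [])    (a<M ∷ _)           =
      reflexive (peakWeight-nonpeak [] (λ (_ , M<a) → ℕₚ.<-asym a<M M<a))
    peakWeight-∷ʳ-max M p (a ∷ b ∷ σ) (a<M ∷ b<M ∷ σ<M)
      with peakWeight-∷ʳ-max M b σ σ<M | peakWeight-∷ʳ-max M a (b ∷ σ) (b<M ∷ σ<M) | isLeftPeak? p a b
    ... | ih | _  | yes _ = trans (*-congˡ ih) (sym (*-assoc A _ U))
    ... | _  | ih | no _  = trans (*-congˡ ih) (sym (*-assoc U _ U))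

  module _ {X Y : Carrier} where

    stepWeight-descent : ∀ {a b} → b < a → stepWeight X Y a b ≡ X
    stepWeight-descent {a} {b} b<a = ≡.cong (λ x → if x then X else Y) (⌊⌋-true (b <? a) b<a)

    stepWeight-ascent : ∀ {a b} → a < b → stepWeight X Y a b ≡ Y
    stepWeight-ascent {a} {b} a<b = ≡.cong (λ x → if x then X else Y) (⌊⌋-false (b <? a) (ℕₚ.<-asym a<b))

    descentWeight-max∷ : ∀ M a σ → a < M → descentWeight X Y (M ∷ a ∷ σ) ≈ X * descentWeight X Y (a ∷ σ)
    descentWeight-max∷ M a σ a<M = *-congʳ (reflexive (stepWeight-descent a<M))

    descentWeight-∷ʳ-max : ∀ M a σ → All (_< M) (a ∷ σ) → descentWeight X Y (a ∷ σ ∷ʳ M) ≈ descentWeight X Y (a ∷ σ) * Y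
    descentWeight-∷ʳ-max M a []      (a<M ∷ _)  = trans (*-congʳ (reflexive (stepWeight-ascent a<M))) (*-comm Y 1#)
    descentWeight-∷ʳ-max M a (b ∷ σ) (_ ∷ bσ<M) = trans (*-congˡ (descentWeight-∷ʳ-max M b σ bσ<M)) (sym (*-assoc _ _ Y))

    descentWeight-pow : ∀ a σ → descentWeight X Y (a ∷ σ) ≈ X ^ des (a ∷ σ) * Y ^ (length σ ∸ des (a ∷ σ))
    descentWeight-pow a []      = sym (*-identityˡ 1#)
    descentWeight-pow a (b ∷ σ) with descentWeight-pow b σ | des≤length b σ | b <? a
    ... | ih | _  | yes _ = trans (*-congˡ ih) (sym (*-assoc X _ _))
    ... | ih | d≤ | no _  = begin
      Y * descentWeight X Y (b ∷ σ)                 ≈⟨ *-congˡ ih ⟩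
      Y * (X ^ d * Y ^ (length σ ∸ d))              ≈⟨ x∙yz≈y∙xz Y _ _ ⟩
      X ^ d * Y ^ suc (length σ ∸ d)                ≡⟨ ≡.cong (λ i → X ^ d * Y ^ i) (ℕₚ.+-∸-assoc 1 d≤) ⟨
      X ^ d * Y ^ (length (b ∷ σ) ∸ d)              ∎
      where
      d = des (b ∷ σ)

  leftSum : Carrier → Carrier → Carrier → Carrier → ℕ → Carrier
  leftSum h x y β n = ∑ (𝔖 n) (λ σ → peakWeight (x * y) (h * (x + y)) 0 σ * β ^ RLmin σ)

  rightSum : Carrier → Carrier → Carrier → Carrier → ℕ → Carrier
  rightSum h x y β n = ∑ (𝔖 (suc n)) (λ σ → descentWeight x y σ * (h * β) ^ excessMinima σ)

  -- Any pow agreeing with _^_ may state the power forms, e.g. the power of Defs.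
  module _ (pow : Carrier → ℕ → Carrier) (^≈pow : ∀ x k → x ^ k ≈ pow x k) where

    leftSum-pow : ∀ h x y β n → leftSum h x y β n ≈
      ∑ (𝔖 n) (λ σ → pow (x * y) (L σ) * (pow (h * (x + y)) (n ∸ 2 ℕ.* L σ) * pow β (RLmin σ)))
    leftSum-pow h x y β n = ∑-cong (𝔖 n) λ {σ} σ∈ → begin
      peakWeight (x * y) (h * (x + y)) 0 σ * β ^ RLmin σ
        ≈⟨ *-congʳ (peakWeight-pow 0 σ) ⟩
      (x * y) ^ L σ * (h * (x + y)) ^ (length σ ∸ 2 ℕ.* L σ) * β ^ RLmin σ
        ≡⟨ ≡.cong (λ m → (x * y) ^ L σ * (h * (x + y)) ^ (m ∸ 2 ℕ.* L σ) * β ^ RLmin σ) (𝔖-length n σ∈) ⟩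
      (x * y) ^ L σ * (h * (x + y)) ^ (n ∸ 2 ℕ.* L σ) * β ^ RLmin σ
        ≈⟨ trans (*-assoc _ _ _) (*-cong (^≈pow _ _) (*-cong (^≈pow _ _) (^≈pow _ _))) ⟩
      pow (x * y) (L σ) * (pow (h * (x + y)) (n ∸ 2 ℕ.* L σ) * pow β (RLmin σ)) ∎

    rightSum-pow : ∀ h x y β n → rightSum h x y β n ≈
      ∑ (𝔖 (suc n)) (λ σ → pow x (des σ) * (pow y (n ∸ des σ) * pow (h * β) (excessMinima σ)))
    rightSum-pow h x y β n = ∑-cong (𝔖 (suc n)) term
      where
      term : ∀ {σ} → σ ∈ 𝔖 (suc n) →
        descentWeight x y σ * (h * β) ^ excessMinima σ ≈ pow x (des σ) * (pow y (n ∸ des σ) * pow (h * β) (excessMinima σ))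
      term {[]}    σ∈ with () ← 𝔖-length (suc n) σ∈
      term {a ∷ σ} σ∈ = begin
        descentWeight x y (a ∷ σ) * (h * β) ^ k
          ≈⟨ *-congʳ (descentWeight-pow a σ) ⟩
        x ^ des (a ∷ σ) * y ^ (length σ ∸ des (a ∷ σ)) * (h * β) ^ k
          ≡⟨ ≡.cong (λ m → x ^ des (a ∷ σ) * y ^ (m ∸ des (a ∷ σ)) * (h * β) ^ k) (ℕₚ.suc-injective (𝔖-length (suc n) σ∈)) ⟩
        x ^ des (a ∷ σ) * y ^ (n ∸ des (a ∷ σ)) * (h * β) ^ k
          ≈⟨ trans (*-assoc _ _ _) (*-cong (^≈pow _ _) (*-cong (^≈pow _ _) (^≈pow _ _))) ⟩
        pow x (des (a ∷ σ)) * (pow y (n ∸ des (a ∷ σ)) * pow (h * β) k) ∎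
        where
        k = excessMinima (a ∷ σ)

module Derivation {c ℓ} (R : CommutativeSemiring c ℓ) where

  open CommutativeSemiring R
  open Sums R
  open Weights R
  open DualNumbers R
  open import Algebra.Definitions.RawSemiring rawSemiring using (_^_)
  open import Relation.Binary.Reasoning.Setoid setoid
  open import Algebra.Solver.Ring.NaturalCoefficients.Default R
  private
    module ε = CommutativeSemiring R[ε]
    module Σε = Sums R[ε]
    module Wε = Weights R[ε]
  open import Algebra.Definitions.RawSemiring ε.rawSemiring using () renaming (_^_ to _^ε_)

  ∑-proj₂ : ∀ {I : Set} (S : List I) f → proj₂ (Σε.∑ S f) ≈ ∑ S (proj₂ ∘ f)
  ∑-proj₂ []      f = refl
  ∑-proj₂ (σ ∷ S) f = +-congˡ (∑-proj₂ S f)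

  ^ε-constant : ∀ {b} → proj₂ b ≈ 0# → ∀ k → (proj₁ (b ^ε k) ≈ proj₁ b ^ k) × (proj₂ (b ^ε k) ≈ 0#)
  ^ε-constant b′≈0 zero    = refl , refl
  ^ε-constant {b} b′≈0 (suc k) with ^ε-constant b′≈0 k
  ... | fst≈ , snd≈0 = *-congˡ fst≈ , (begin
    proj₁ b * proj₂ (b ^ε k) + proj₂ b * proj₁ (b ^ε k) ≈⟨ +-cong (*-congˡ snd≈0) (*-congʳ b′≈0) ⟩
    proj₁ b * 0# + 0# * proj₁ (b ^ε k)                 ≈⟨ +-cong (zeroʳ _) (zeroˡ _) ⟩
    0# + 0#                                             ≈⟨ +-identityˡ 0# ⟩
    0#                                                  ∎)

  proj₂-*-^ε-constant : ∀ {b} → proj₂ b ≈ 0# → ∀ u k → proj₂ (u *ε b ^ε k) ≈ proj₂ u * proj₁ b ^ k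
  proj₂-*-^ε-constant {b} b′≈0 u k with ^ε-constant b′≈0 k
  ... | fst≈ , snd≈0 = begin
    proj₁ u * proj₂ (b ^ε k) + proj₂ u * proj₁ (b ^ε k) ≈⟨ +-cong (trans (*-congˡ snd≈0) (zeroʳ _)) (*-congˡ fst≈) ⟩
    0# + proj₂ u * proj₁ b ^ k                         ≈⟨ +-identityˡ _ ⟩
    proj₂ u * proj₁ b ^ k                              ∎

  ∑-𝔖-suc : ∀ n a f g → (∀ {σ} → σ ∈ 𝔖 n → ∑ (insertions (suc n) σ) f ≈ a * f σ + proj₂ (g σ)) →
    ∑ (𝔖 (suc n)) f ≈ a * ∑ (𝔖 n) f + proj₂ (Σε.∑ (𝔖 n) g)
  ∑-𝔖-suc n a f g per-σ = begin
    ∑ (𝔖 (suc n)) f                                          ≈⟨ ∑-↭ f (𝔖-suc-↭ n) ⟩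
    ∑ (concatMap (insertions (suc n)) (𝔖 n)) f               ≈⟨ ∑-concatMap (insertions (suc n)) (𝔖 n) f ⟩
    ∑ (𝔖 n) (λ σ → ∑ (insertions (suc n) σ) f)               ≈⟨ ∑-cong (𝔖 n) per-σ ⟩
    ∑ (𝔖 n) (λ σ → a * f σ + proj₂ (g σ))                    ≈⟨ ∑-+ (𝔖 n) _ _ ⟩
    ∑ (𝔖 n) (λ σ → a * f σ) + ∑ (𝔖 n) (λ σ → proj₂ (g σ))    ≈⟨ +-cong (∑-*ˡ (𝔖 n) a f) (sym (∑-proj₂ (𝔖 n) g)) ⟩
    a * ∑ (𝔖 n) f + proj₂ (Σε.∑ (𝔖 n) g)                     ∎

  ∑-insertions : ∀ M σ f → ∑ (insertions M σ) f ≈ ∑ (innerInsertions M σ) f + f (σ ∷ʳ M)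
  ∑-insertions M σ f = begin
    ∑ (insertions M σ) f                                ≡⟨ ≡.cong (λ S → ∑ S f) (insertions≡innerInsertions∷ʳ M σ) ⟩
    ∑ (innerInsertions M σ ∷ʳ (σ ∷ʳ M)) f               ≈⟨ ∑-++ (innerInsertions M σ) _ f ⟩
    ∑ (innerInsertions M σ) f + (f (σ ∷ʳ M) + 0#)       ≈⟨ +-congˡ (+-identityʳ _) ⟩
    ∑ (innerInsertions M σ) f + f (σ ∷ʳ M)              ∎

  module _ {A U A′ U′ : Carrier} where
    private
      w = peakWeight A U
      ŵ = Wε.peakWeight (A , A′) (U , U′)

    peakWeight-proj₁ : ∀ p σ → proj₁ (ŵ p σ) ≈ w p σ
    peakWeight-proj₁ p []          = refl
    peakWeight-proj₁ p (a ∷ [])    = refl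
    peakWeight-proj₁ p (a ∷ b ∷ σ) with peakWeight-proj₁ b σ | peakWeight-proj₁ a (b ∷ σ) | isLeftPeak? p a b
    ... | ih | _  | yes _ = *-congˡ ih
    ... | _  | ih | no _  = *-congˡ ih

    peakWeight-innerInsertions : A′ ≈ (U + U) * A → U′ ≈ A → ∀ M p σ → p < M → All (_< M) σ →
      ∑ (innerInsertions M σ) (w p) ≈ proj₂ (ŵ p σ)
    peakWeight-innerInsertions A′≈ U′≈ M p []          _   _                 = refl
    peakWeight-innerInsertions A′≈ U′≈ M p (a ∷ [])    p<M (a<M ∷ _)         = begin
      w p (M ∷ a ∷ []) + 0#   ≡⟨ ≡.cong (_+ 0#) (peakWeight-peak [] (p<M , a<M)) ⟩
      A * 1# + 0#             ≈⟨ trans (+-identityʳ _) (*-identityʳ A) ⟩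
      A                       ≈⟨ sym U′≈ ⟩
      U′                      ∎
    peakWeight-innerInsertions A′≈ U′≈ M p (a ∷ b ∷ σ) p<M (a<M ∷ b<M ∷ σ<M)
      with peakWeight-innerInsertions A′≈ U′≈ M b σ b<M σ<M
         | peakWeight-innerInsertions A′≈ U′≈ M a (b ∷ σ) a<M (b<M ∷ σ<M)
         | isLeftPeak? p a b
    ... | ih | _ | yes peak@(_ , b<a) = begin
      w p (M ∷ a ∷ b ∷ σ) + (w p (a ∷ M ∷ b ∷ σ) + ∑ (map (a ∷_) (map (b ∷_) (innerInsertions M σ))) (w p))
        ≡⟨ ≡.cong₂ (λ s t → s + (w p (a ∷ M ∷ b ∷ σ) + t)) (peakWeight-peak (b ∷ σ) (p<M , a<M))
             (≡.trans (∑-map (a ∷_) (map (b ∷_) (innerInsertions M σ)) (w p)) (∑-map (b ∷_) (innerInsertions M σ) (w p ∘ (a ∷_)))) ⟩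
      A * w a (b ∷ σ) + (w p (a ∷ M ∷ b ∷ σ) + ∑ (innerInsertions M σ) (λ t → w p (a ∷ b ∷ t)))
        ≈⟨ +-cong (*-congˡ (peakWeight-descent σ b<a))
                  (+-cong (reflexive (≡.trans (peakWeight-nonpeak (b ∷ σ) (λ (_ , M<a) → ℕₚ.<-asym a<M M<a))
                                              (≡.cong (U *_) (peakWeight-peak σ (a<M , b<M)))))
                          (∑-cong (innerInsertions M σ) (λ {t} _ → reflexive (peakWeight-peak t peak)))) ⟩
      A * (U * w b σ) + (U * (A * w b σ) + ∑ (innerInsertions M σ) (λ t → A * w b t))
        ≈⟨ +-congˡ (+-congˡ (trans (∑-*ˡ (innerInsertions M σ) A (w b)) (*-congˡ ih))) ⟩
      A * (U * w b σ) + (U * (A * w b σ) + A * proj₂ (ŵ b σ))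
        ≈⟨ solve 4 (λ a u v s → a :* (u :* v) :+ (u :* (a :* v) :+ a :* s) := a :* s :+ ((u :+ u) :* a) :* v)
                   refl A U (w b σ) (proj₂ (ŵ b σ)) ⟩
      A * proj₂ (ŵ b σ) + ((U + U) * A) * w b σ
        ≈⟨ +-congˡ (*-cong (sym A′≈) (sym (peakWeight-proj₁ b σ))) ⟩
      A * proj₂ (ŵ b σ) + A′ * proj₁ (ŵ b σ)
        ∎
    ... | _ | ih | no ¬peak = begin
      w p (M ∷ a ∷ b ∷ σ) + ∑ (map (a ∷_) (innerInsertions M (b ∷ σ))) (w p)
        ≡⟨ ≡.cong₂ _+_ (peakWeight-peak (b ∷ σ) (p<M , a<M)) (∑-map (a ∷_) (innerInsertions M (b ∷ σ)) (w p)) ⟩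
      A * w a (b ∷ σ) + ∑ (innerInsertions M (b ∷ σ)) (λ τ → w p (a ∷ τ))
        ≈⟨ +-congˡ (∑-cong (innerInsertions M (b ∷ σ)) (reflexive ∘ nonpeak)) ⟩
      A * w a (b ∷ σ) + ∑ (innerInsertions M (b ∷ σ)) (λ τ → U * w a τ)
        ≈⟨ +-congˡ (trans (∑-*ˡ (innerInsertions M (b ∷ σ)) U (w a)) (*-congˡ ih)) ⟩
      A * w a (b ∷ σ) + U * proj₂ (ŵ a (b ∷ σ))
        ≈⟨ trans (+-comm _ _) (+-congˡ (*-cong (sym U′≈) (sym (peakWeight-proj₁ a (b ∷ σ))))) ⟩
      U * proj₂ (ŵ a (b ∷ σ)) + U′ * proj₁ (ŵ a (b ∷ σ))
        ∎
      where
      nonpeak : ∀ {τ} → τ ∈ innerInsertions M (b ∷ σ) → w p (a ∷ τ) ≡ U * w a τ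
      nonpeak (here ≡.refl) = peakWeight-nonpeak (b ∷ σ) (λ (_ , M<a) → ℕₚ.<-asym a<M M<a)
      nonpeak (there τ∈) with map∷⁻ τ∈
      ... | t , _ , ≡.refl = peakWeight-nonpeak t ¬peak

  module _ {X Y : Carrier} where
    private
      d = descentWeight X Y
      d̂ = Wε.descentWeight (X , X * Y) (Y , X * Y)
      ĝ = Wε.stepWeight (X , X * Y) (Y , X * Y)

    stepWeight-proj₁ : ∀ a b → proj₁ (ĝ a b) ≡ stepWeight X Y a b
    stepWeight-proj₁ a b with b <? a
    ... | yes _ = ≡.refl
    ... | no _  = ≡.refl

    stepWeight-proj₂ : ∀ a b → proj₂ (ĝ a b) ≡ X * Y
    stepWeight-proj₂ a b with b <? a
    ... | yes _ = ≡.refl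
    ... | no _  = ≡.refl

    descentWeight-proj₁ : ∀ σ → proj₁ (d̂ σ) ≈ d σ
    descentWeight-proj₁ (a ∷ b ∷ σ) = *-cong (reflexive (stepWeight-proj₁ a b)) (descentWeight-proj₁ (b ∷ σ))
    descentWeight-proj₁ []          = refl
    descentWeight-proj₁ (a ∷ [])    = refl

    descentWeight-innerInsertions : ∀ M a σ → All (_< M) (a ∷ σ) →
      ∑ (innerInsertions M σ) (λ τ → d (a ∷ τ)) ≈ proj₂ (d̂ (a ∷ σ))
    descentWeight-innerInsertions M a []      _                 = refl
    descentWeight-innerInsertions M a (b ∷ σ) (a<M ∷ b<M ∷ σ<M) = begin
      d (a ∷ M ∷ b ∷ σ) + ∑ (map (b ∷_) (innerInsertions M σ)) (λ τ → d (a ∷ τ))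
        ≡⟨ ≡.cong (d (a ∷ M ∷ b ∷ σ) +_) (∑-map (b ∷_) (innerInsertions M σ) (λ τ → d (a ∷ τ))) ⟩
      d (a ∷ M ∷ b ∷ σ) + ∑ (innerInsertions M σ) (λ t → g * d (b ∷ t))
        ≈⟨ +-cong (*-cong (reflexive (stepWeight-ascent a<M)) (*-congʳ (reflexive (stepWeight-descent b<M))))
                  (∑-*ˡ (innerInsertions M σ) g (λ t → d (b ∷ t))) ⟩
      Y * (X * d (b ∷ σ)) + g * ∑ (innerInsertions M σ) (λ t → d (b ∷ t))
        ≈⟨ +-congˡ (*-congˡ (descentWeight-innerInsertions M b σ (b<M ∷ σ<M))) ⟩
      Y * (X * d (b ∷ σ)) + g * proj₂ (d̂ (b ∷ σ))
        ≈⟨ solve 5 (λ y x v g s → y :* (x :* v) :+ g :* s := g :* s :+ (x :* y) :* v) refl Y X (d (b ∷ σ)) g _ ⟩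
      g * proj₂ (d̂ (b ∷ σ)) + (X * Y) * d (b ∷ σ)
        ≈⟨ +-cong (*-congʳ (reflexive (≡.sym (stepWeight-proj₁ a b))))
                  (*-cong (reflexive (≡.sym (stepWeight-proj₂ a b))) (sym (descentWeight-proj₁ (b ∷ σ)))) ⟩
      proj₁ (ĝ a b) * proj₂ (d̂ (b ∷ σ)) + proj₂ (ĝ a b) * proj₁ (d̂ (b ∷ σ))
        ∎
      where
      g = stepWeight X Y a b

  module Recurrences (h x y β : Carrier) (h+h≈1 : h + h ≈ 1#) where
    private
      A U : Carrier
      A = x * y
      U = h * (x + y)
    -- The ε-parts encode D x = D y = x y and D h = D β = 0.
    ĥ x̂ ŷ β̂ : Carrier × Carrier
    ĥ = h , 0#
    x̂ = x , x * y
    ŷ = y , x * y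
    β̂ = β , 0#

    leftSum-suc : ∀ n → leftSum h x y β (suc n) ≈ (U * β) * leftSum h x y β n + proj₂ (Wε.leftSum ĥ x̂ ŷ β̂ n)
    leftSum-suc n = ∑-𝔖-suc n (U * β) _ _ per-σ
      where
      A′≈ : x * (x * y) + (x * y) * y ≈ (U + U) * A
      A′≈ = begin
        x * (x * y) + (x * y) * y   ≈⟨ solve 3 (λ h x y → x :* (x :* y) :+ (x :* y) :* y := con 1 :* (x :+ y) :* (x :* y)) refl h x y ⟩
        1# * (x + y) * (x * y)      ≈⟨ *-congʳ (*-congʳ (sym h+h≈1)) ⟩
        (h + h) * (x + y) * (x * y) ≈⟨ solve 3 (λ h x y → (h :+ h) :* (x :+ y) :* (x :* y)
                                                     := (h :* (x :+ y) :+ h :* (x :+ y)) :* (x :* y)) refl h x y ⟩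
        (U + U) * A                 ∎
      U′≈ : h * (x * y + x * y) + 0# * (x + y) ≈ A
      U′≈ = begin
        h * (x * y + x * y) + 0# * (x + y) ≈⟨ solve 3 (λ h x y → h :* (x :* y :+ x :* y) :+ con 0 :* (x :+ y)
                                                            := (h :+ h) :* (x :* y)) refl h x y ⟩
        (h + h) * (x * y)                  ≈⟨ trans (*-congʳ h+h≈1) (*-identityˡ _) ⟩
        x * y                              ∎
      w = peakWeight A U 0
      per-σ : ∀ {σ} → σ ∈ 𝔖 n → ∑ (insertions (suc n) σ) (λ τ → w τ * β ^ RLmin τ) ≈
        (U * β) * (w σ * β ^ RLmin σ) + proj₂ (Wε.peakWeight (x̂ *ε ŷ) (ĥ *ε (x̂ ε.+ ŷ)) 0 σ *ε β̂ ^ε RLmin σ)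
      per-σ {σ} σ∈ = begin
        ∑ (insertions M σ) (λ τ → w τ * β ^ RLmin τ)
          ≈⟨ ∑-insertions M σ _ ⟩
        ∑ (innerInsertions M σ) (λ τ → w τ * β ^ RLmin τ) + w (σ ∷ʳ M) * β ^ RLmin (σ ∷ʳ M)
          ≈⟨ +-cong (∑-cong (innerInsertions M σ) (λ τ∈ → *-congˡ (reflexive (≡.cong (β ^_) (RLmin-innerInsertions M σ σ<M τ∈)))))
                    (*-cong (peakWeight-∷ʳ-max M 0 σ σ<M) (reflexive (≡.cong (β ^_) (RLmin-∷ʳ-max M σ σ<M)))) ⟩
        ∑ (innerInsertions M σ) (λ τ → w τ * β ^ k) + w σ * U * (β * β ^ k)
          ≈⟨ +-congʳ (trans (∑-*ʳ (innerInsertions M σ) (β ^ k) w)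
                            (*-congʳ (peakWeight-innerInsertions A′≈ U′≈ M 0 σ (s≤s z≤n) σ<M))) ⟩
        proj₂ ŵ * β ^ k + w σ * U * (β * β ^ k)
          ≈⟨ solve 5 (λ s p v u b → s :* p :+ v :* u :* (b :* p) := (u :* b) :* (v :* p) :+ s :* p) refl _ _ (w σ) U β ⟩
        (U * β) * (w σ * β ^ k) + proj₂ ŵ * β ^ k
          ≈⟨ +-congˡ (sym (proj₂-*-^ε-constant refl ŵ k)) ⟩
        (U * β) * (w σ * β ^ k) + proj₂ (ŵ *ε β̂ ^ε k)
          ∎
        where
        M = suc n
        k = RLmin σ
        σ<M = 𝔖-bounded n σ∈
        ŵ = Wε.peakWeight (x̂ *ε ŷ) (ĥ *ε (x̂ ε.+ ŷ)) 0 σ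

    rightSum-suc : ∀ n → rightSum h x y β (suc n) ≈ (U * β) * rightSum h x y β n + proj₂ (Wε.rightSum ĥ x̂ ŷ β̂ n)
    rightSum-suc n = ∑-𝔖-suc (suc n) (U * β) _ _ per-σ
      where
      γ = h * β
      ĉ = ĥ *ε β̂
      ĉ′≈0 : proj₂ ĉ ≈ 0#
      ĉ′≈0 = trans (+-cong (zeroʳ h) (zeroˡ β)) (+-identityˡ 0#)
      d = descentWeight x y
      d̂ = Wε.descentWeight x̂ ŷ
      W : List ℕ → Carrier
      W τ = d τ * γ ^ excessMinima τ
      per-σ : ∀ {σ} → σ ∈ 𝔖 (suc n) → ∑ (insertions (suc (suc n)) σ) W ≈
        (U * β) * W σ + proj₂ (d̂ σ *ε ĉ ^ε excessMinima σ)
      per-σ {[]}    σ∈ with () ← 𝔖-length (suc n) σ∈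
      per-σ {a ∷ σ} σ∈ = begin
        W (M ∷ a ∷ σ) + ∑ (map (a ∷_) (insertions M σ)) W
          ≡⟨ ≡.cong (W (M ∷ a ∷ σ) +_) (∑-map (a ∷_) (insertions M σ) W) ⟩
        W (M ∷ a ∷ σ) + ∑ (insertions M σ) (W ∘ (a ∷_))
          ≈⟨ +-congˡ (∑-insertions M σ (W ∘ (a ∷_))) ⟩
        W (M ∷ a ∷ σ) + (∑ (innerInsertions M σ) (W ∘ (a ∷_)) + W (a ∷ σ ∷ʳ M))
          ≈⟨ +-cong (*-cong (descentWeight-max∷ M a σ a<M) (reflexive (≡.cong (γ ^_) (excessMinima-max∷ M a σ aσ<M))))
                    (+-cong inner (*-cong (descentWeight-∷ʳ-max M a σ aσ<M) (reflexive (≡.cong (γ ^_) (excessMinima-∷ʳ-max M a σ aσ<M))))) ⟩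
        x * d (a ∷ σ) * (γ * γ ^ k) + (proj₂ (d̂ (a ∷ σ)) * γ ^ k + d (a ∷ σ) * y * (γ * γ ^ k))
          ≈⟨ solve 7 (λ x y h b v s p → x :* v :* ((h :* b) :* p) :+ (s :* p :+ v :* y :* ((h :* b) :* p))
                                       := (h :* (x :+ y) :* b) :* (v :* p) :+ s :* p) refl x y h β (d (a ∷ σ)) _ (γ ^ k) ⟩
        (U * β) * W (a ∷ σ) + proj₂ (d̂ (a ∷ σ)) * γ ^ k
          ≈⟨ +-congˡ (sym (proj₂-*-^ε-constant ĉ′≈0 (d̂ (a ∷ σ)) k)) ⟩
        (U * β) * W (a ∷ σ) + proj₂ (d̂ (a ∷ σ) *ε ĉ ^ε k)
          ∎
        where
        M = suc (suc n)
        k = excessMinima (a ∷ σ)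
        aσ<M = 𝔖-bounded (suc n) σ∈
        a<M = All.head aσ<M
        inner : ∑ (innerInsertions M σ) (W ∘ (a ∷_)) ≈ proj₂ (d̂ (a ∷ σ)) * γ ^ k
        inner = begin
          ∑ (innerInsertions M σ) (W ∘ (a ∷_))
            ≈⟨ ∑-cong (innerInsertions M σ) (λ τ∈ → *-congˡ (reflexive (≡.cong (γ ^_) (excessMinima-innerInsertions M a σ aσ<M τ∈)))) ⟩
          ∑ (innerInsertions M σ) (λ τ → d (a ∷ τ) * γ ^ k)
            ≈⟨ ∑-*ʳ (innerInsertions M σ) (γ ^ k) (d ∘ (a ∷_)) ⟩
          ∑ (innerInsertions M σ) (d ∘ (a ∷_)) * γ ^ k
            ≈⟨ *-congʳ (descentWeight-innerInsertions M a σ aσ<M) ⟩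
          proj₂ (d̂ (a ∷ σ)) * γ ^ k
            ∎

leftSum≈rightSum : ∀ n {c ℓ} (R : CommutativeSemiring c ℓ) → let open CommutativeSemiring R; open Weights R in
  ∀ h x y β → h + h ≈ 1# → leftSum h x y β n ≈ rightSum h x y β n
leftSum≈rightSum zero    R h x y β _      = CommutativeSemiring.refl R
leftSum≈rightSum (suc n) R h x y β h+h≈1 = begin
  leftSum h x y β (suc n)
    ≈⟨ leftSum-suc n ⟩
  (h * (x + y) * β) * leftSum h x y β n + proj₂ (Wε.leftSum ĥ x̂ ŷ β̂ n)
    ≈⟨ +-cong (*-congˡ (leftSum≈rightSum n R h x y β h+h≈1))
              (proj₂ (leftSum≈rightSum n R[ε] ĥ x̂ ŷ β̂ (h+h≈1 , +-identityˡ 0#))) ⟩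
  (h * (x + y) * β) * rightSum h x y β n + proj₂ (Wε.rightSum ĥ x̂ ŷ β̂ n)
    ≈⟨ rightSum-suc n ⟨
  rightSum h x y β (suc n)
    ∎
  where
  open CommutativeSemiring R
  open Weights R
  open DualNumbers R
  open Derivation R
  open Recurrences h x y β h+h≈1
  open import Relation.Binary.Reasoning.Setoid setoid
  module Wε = Weights R[ε]

open import Algebra using (CommutativeRing)
open import Data.Rational using (ℚ; ½; _+_; _*_)
import Data.Rational.Properties as ℚₚ
open import Defs using (_^_)
open ≡ using (refl; cong; module ≡-Reasoning)

ℚ-commutativeSemiring : CommutativeSemiring _ _
ℚ-commutativeSemiring = CommutativeRing.commutativeSemiring ℚₚ.+-*-commutativeRing

open import Algebra.Definitions.RawSemiring (CommutativeSemiring.rawSemiring ℚ-commutativeSemiring)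
  using () renaming (_^_ to _^ᵣ_)
open Weights ℚ-commutativeSemiring using (leftSum; rightSum; leftSum-pow; rightSum-pow)

^ᵣ≡^ : ∀ x k → x ^ᵣ k ≡ x ^ k
^ᵣ≡^ x zero    = refl
^ᵣ≡^ x (suc k) = cong (x *_) (^ᵣ≡^ x k)

mainTheorem7 : (n : ℕ) (x y β : ℚ) →
    sumOver (𝔖 n) (λ σ → ((x * y) ^ L σ) * (((½ * (x + y)) ^ (n ∸ 2 ℕ.* L σ)) * (β ^ RLmin σ)))
    ≡ sumOver (𝔖 (suc n)) (λ σ → (x ^ des σ) * ((y ^ (n ∸ des σ)) * ((½ * β) ^ (LRmin σ ℕ.+ RLmin σ ∸ 2))))
mainTheorem7 n x y β = begin
  sumOver (𝔖 n) (λ σ → ((x * y) ^ L σ) * (((½ * (x + y)) ^ (n ∸ 2 ℕ.* L σ)) * (β ^ RLmin σ)))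
    ≡⟨ leftSum-pow _^_ ^ᵣ≡^ ½ x y β n ⟨
  leftSum ½ x y β n
    ≡⟨ leftSum≈rightSum n ℚ-commutativeSemiring ½ x y β refl ⟩
  rightSum ½ x y β n
    ≡⟨ rightSum-pow _^_ ^ᵣ≡^ ½ x y β n ⟩
  sumOver (𝔖 (suc n)) (λ σ → (x ^ des σ) * ((y ^ (n ∸ des σ)) * ((½ * β) ^ (LRmin σ ℕ.+ RLmin σ ∸ 2)))) ∎
  where open ≡-Reasoning
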